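{- Let $n\ge 3$ be an odd integer and $0\le k\le n-1$. Then \[ B_{n,k} = (n-k)B_{n-1,k-1} + (k+1)B_{n-1,k},\qquad C_{n,k} = (n-k)C_{n-1,k-1} + (k+1)C_{n-1,k}. \]
   Context: Permutations of $[m]=\{1,\dots,m\}$ are written as words $a_1a_2\cdots a_m$. An ascent is an index $i$ ($1\le i\le m-1$) with $a_i<a_{i+1}$. An inversion is a pair $(i,j)$ with $1\le i<j\le m$ and $a_i>a_j$. For any integer $k$, $E(m,k)$ is the set of permutations of $[m]$ with exactly $k$ ascents (empty if $k<0$ or $k>m-1$); $E_{\rm e}(m,k)$ and $E_{\rm o}(m,k)$ are its subsets of permutations with an even, respectively odd, number of inversions; $B_{m,k}=|E_{\rm e}(m,k)|$ and $C_{m,k}=|E_{\rm o}(m,k)|$ (so these are $0$ for $k$ out of range). -}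

module Defs where

open import Data.Nat using (ℕ; zero; suc; _+_; _<ᵇ_)
open import Data.Integer using (ℤ; +_; -[1+_])
open import Data.Bool using (Bool; true; false; if_then_else_; _∧_; not)
open import Data.List using (List; []; _∷_; map; concatMap; filter; length; upTo; allFin)
open import Data.Fin using (Fin; toℕ)
open import Data.Nat.Properties using (_≟_)
open import Relation.Nullary.Decidable using (⌊_⌋)
open import Relation.Unary using (Decidable)
open import Data.Bool.Properties using (T?)
open import Data.Product using (_×_; _,_)

words : ℕ → ℕ → List (List ℕ)
words m zero = [] ∷ []
words m (suc len) = concatMap (λ w → map (λ a → suc a ∷ w) (upTo m)) (words m len)

memb : ℕ → List ℕ → Bool
memb x [] = false
memb x (y ∷ ys) = if ⌊ x ≟ y ⌋ then true else memb x ys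

distinct : List ℕ → Bool
distinct [] = true
distinct (x ∷ xs) = not (memb x xs) ∧ distinct xs

perms : ℕ → List (List ℕ)
perms m = filter (λ w → T? (distinct w)) (words m m)

ascents : List ℕ → ℕ
ascents [] = 0
ascents (x ∷ []) = 0
ascents (x ∷ y ∷ ys) = (if x <ᵇ y then 1 else 0) + ascents (y ∷ ys)

countSmaller : ℕ → List ℕ → ℕ
countSmaller x [] = 0
countSmaller x (y ∷ ys) = (if y <ᵇ x then 1 else 0) + countSmaller x ys

inversions : List ℕ → ℕ
inversions [] = 0
inversions (x ∷ xs) = countSmaller x xs + inversions xs

even : ℕ → Bool
even zero = true
even (suc n) = not (even n)

hasAscents : ℤ → List ℕ → Bool
hasAscents (+ k) w = ⌊ ascents w ≟ k ⌋
hasAscents -[1+ _ ] w = false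

E : ℕ → ℤ → List (List ℕ)
E m k = filter (λ w → T? (hasAscents k w)) (perms m)

Ee : ℕ → ℤ → List (List ℕ)
Ee m k = filter (λ w → T? (even (inversions w))) (E m k)

Eo : ℕ → ℤ → List (List ℕ)
Eo m k = filter (λ w → T? (not (even (inversions w)))) (E m k)

B : ℕ → ℤ → ℕ
B m k = length (Ee m k)

C : ℕ → ℤ → ℕ
C m k = length (Eo m k)

-- Write n = N + 1 with N = 2M. Every permutation of [n] arises exactly once by inserting the
-- letter n into a permutation σ of [N] at a position i ∈ {0, …, N}. If σ has s ascents, the
-- inserted word has s ascents for i = 0 and for the s positions inside an ascent of σ, and
-- s + 1 ascents for the remaining N − s positions; summing over i yields the Eulerian recurrence
-- (k + 1)·[s = k] + (n − k)·[s = k − 1]. Insertion at position i adds N − i inversions, so for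
-- even i the parity is kept. For odd i it is reversed, but this does not change the counts:
-- the first i letters of σ are an odd number of letters, so some pair {2c + 1, 2c + 2} has
-- exactly one of its values among them, and exchanging the two values of the last such pair is
-- an involution on the permutations of [N] that preserves the ascents of the inserted word and
-- reverses the parity.

module Submission where

open import Defs
open import Data.Nat using (ℕ; zero; suc; _+_; _*_; _∸_; _≤_; _<_; z≤n; s≤s; _<ᵇ_; _≟_)
open import Relation.Binary.PropositionalEquality using (_≡_; _≢_; refl; sym; trans; cong; cong₂; subst; setoid; module ≡-Reasoning)
open import Data.Bool using (Bool; true; false; not; _∧_; _xor_; T; if_then_else_)
open import Data.Bool.Properties using (T?; T-≡; not-involutive; not-distribˡ-xor; not-distribʳ-xor; xor-comm)
open import Data.List using (List; []; _∷_; [_]; _++_; concatMap; map; filter; length; take; drop; upTo; cartesianProduct; cartesianProductWith)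
open import Data.List.Membership.DecPropositional _≟_ using (_∈?_)
open import Data.List.Membership.Propositional using (_∈_; _∉_)
open import Data.List.Membership.Propositional.Properties
open import Data.List.Membership.Propositional.Properties.WithK using (unique∧set⇒bag)
open import Data.List.Properties using (∷-injective; ∷-injectiveˡ; ∷-injectiveʳ; length-++; length-map; length-upTo; length-take; length-drop; map-++; map-∘; map-cong; map-id; map-upTo; upTo-∷ʳ; take++drop≡id; take-map; drop-map; filter-notAll)
open import Data.List.Relation.Binary.BagAndSetEquality using (∼bag⇒↭)
open import Data.List.Relation.Binary.Permutation.Propositional using (_↭_; ↭-sym; ↭-trans; ↭-prep; ↭-reflexive; ↭⇒↭ₛ)
open import Data.List.Relation.Binary.Permutation.Propositional.Properties using (map⁺; ↭-length; shift; All-resp-↭)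
open import Data.List.Relation.Binary.Permutation.Setoid.Properties (setoid ℕ) using (Unique-resp-↭)
open import Data.List.Relation.Binary.Subset.Propositional using (_⊆_)
open import Data.List.Relation.Unary.All as All using (All; []; _∷_)
open import Data.List.Relation.Unary.All.Properties as All using ()
open import Data.List.Relation.Unary.Any as Any using (here; there)
open import Data.List.Relation.Unary.Unique.Propositional using (Unique; []; _∷_)
open import Data.List.Relation.Unary.Unique.Propositional.Properties as Unique using ()
open import Data.Nat.ListAction using (sum)
open import Data.Nat.ListAction.Properties using (sum-++; sum-↭)
open import Data.Nat.Properties
open import Algebra.Properties.CommutativeSemigroup +-commutativeSemigroup using (interchange; x∙yz≈y∙xz)
open import Data.Nat.Tactic.RingSolver using (solve-∀)
open import Data.Product using (_×_; _,_; proj₁; proj₂; ∃)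
open import Data.Sum using (_⊎_; inj₁; inj₂)
open import Function using (_∘_; _⇔_; mk⇔; Equivalence; case_of_)
open import Relation.Nullary using (¬_; yes; no; contradiction)
open import Relation.Nullary.Decidable using (⌊_⌋)

private variable
  X Y : Set

-- Finite sums

𝟙 : Bool → ℕ
𝟙 b = if b then 1 else 0

∑ : List X → (X → ℕ) → ℕ
∑ xs f = sum (map f xs)

∑-++ : ∀ xs ys (f : X → ℕ) → ∑ (xs ++ ys) f ≡ ∑ xs f + ∑ ys f
∑-++ xs ys f = trans (cong sum (map-++ f xs ys)) (sum-++ (map f xs) (map f ys))

∑-map : ∀ (g : X → Y) xs (f : Y → ℕ) → ∑ (map g xs) f ≡ ∑ xs (f ∘ g)
∑-map g xs f = cong sum (sym (map-∘ xs))

∑-cong : ∀ {xs} {f g : X → ℕ} → (∀ {x} → x ∈ xs → f x ≡ g x) → ∑ xs f ≡ ∑ xs g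
∑-cong {xs = []}     f≡g = refl
∑-cong {xs = x ∷ xs} f≡g = cong₂ _+_ (f≡g (here refl)) (∑-cong (f≡g ∘ there))

∑-zero : ∀ (xs : List X) → ∑ xs (λ _ → 0) ≡ 0
∑-zero []       = refl
∑-zero (x ∷ xs) = ∑-zero xs

∑-+ : ∀ xs (f g : X → ℕ) → ∑ xs (λ x → f x + g x) ≡ ∑ xs f + ∑ xs g
∑-+ []       f g = refl
∑-+ (x ∷ xs) f g = begin
  f x + g x + ∑ xs (λ x → f x + g x) ≡⟨ cong ((f x + g x) +_) (∑-+ xs f g) ⟩
  f x + g x + (∑ xs f + ∑ xs g)      ≡⟨ interchange (f x) (g x) (∑ xs f) (∑ xs g) ⟩
  f x + ∑ xs f + (g x + ∑ xs g)      ∎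
  where open ≡-Reasoning

∑-*ˡ : ∀ c xs (f : X → ℕ) → ∑ xs (λ x → c * f x) ≡ c * ∑ xs f
∑-*ˡ c []       f = sym (*-zeroʳ c)
∑-*ˡ c (x ∷ xs) f = trans (cong (c * f x +_) (∑-*ˡ c xs f)) (sym (*-distribˡ-+ c (f x) (∑ xs f)))

∑-comm : ∀ xs ys (f : X → Y → ℕ) → ∑ xs (λ x → ∑ ys (f x)) ≡ ∑ ys (λ y → ∑ xs (λ x → f x y))
∑-comm []       ys f = sym (∑-zero ys)
∑-comm (x ∷ xs) ys f =
  trans (cong (∑ ys (f x) +_) (∑-comm xs ys f)) (sym (∑-+ ys (f x) (λ y → ∑ xs (λ x → f x y))))

∑-cartesianProduct : ∀ xs ys (f : X × Y → ℕ) →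
  ∑ (cartesianProduct xs ys) f ≡ ∑ xs (λ x → ∑ ys (λ y → f (x , y)))
∑-cartesianProduct []       ys f = refl
∑-cartesianProduct (x ∷ xs) ys f = begin
  ∑ (map (x ,_) ys ++ cartesianProduct xs ys) f           ≡⟨ ∑-++ (map (x ,_) ys) _ f ⟩
  ∑ (map (x ,_) ys) f + ∑ (cartesianProduct xs ys) f    ≡⟨ cong₂ _+_ (∑-map (x ,_) ys f) (∑-cartesianProduct xs ys f) ⟩
  ∑ ys (λ y → f (x , y)) + ∑ xs (λ x → ∑ ys (λ y → f (x , y))) ∎
  where open ≡-Reasoning

∑-↭ : ∀ {xs ys} (f : X → ℕ) → xs ↭ ys → ∑ xs f ≡ ∑ ys f
∑-↭ f xs↭ys = sum-↭ (map⁺ f xs↭ys)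

∑-upTo-suc : ∀ n (f : ℕ → ℕ) → ∑ (upTo (suc n)) f ≡ f 0 + ∑ (upTo n) (f ∘ suc)
∑-upTo-suc n f = cong sum (trans (map-upTo f (suc n)) (cong (f 0 ∷_) (sym (map-upTo (f ∘ suc) n))))

∑-upTo-∷ʳ : ∀ n (f : ℕ → ℕ) → ∑ (upTo (suc n)) f ≡ ∑ (upTo n) f + f n
∑-upTo-∷ʳ n f = begin
  ∑ (upTo (suc n)) f        ≡⟨ cong (λ is → ∑ is f) (upTo-∷ʳ n) ⟨
  ∑ (upTo n ++ [ n ]) f     ≡⟨ ∑-++ (upTo n) [ n ] f ⟩
  ∑ (upTo n) f + (f n + 0)  ≡⟨ cong (∑ (upTo n) f +_) (+-identityʳ (f n)) ⟩
  ∑ (upTo n) f + f n        ∎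
  where open ≡-Reasoning

∑-upTo-double : ∀ n (g : ℕ → ℕ) → ∑ (upTo (n + n)) g ≡ ∑ (upTo n) (λ c → g (c + c) + g (suc (c + c)))
∑-upTo-double zero    g = refl
∑-upTo-double (suc n) g = begin
  ∑ (upTo (suc n + suc n)) g                        ≡⟨ cong (λ m → ∑ (upTo (suc m)) g) (+-suc n n) ⟩
  ∑ (upTo (suc (suc (n + n)))) g                    ≡⟨ ∑-upTo-∷ʳ (suc (n + n)) g ⟩
  ∑ (upTo (suc (n + n))) g + g (suc (n + n))        ≡⟨ cong (_+ g (suc (n + n))) (∑-upTo-∷ʳ (n + n) g) ⟩
  ∑ (upTo (n + n)) g + g (n + n) + g (suc (n + n))  ≡⟨ +-assoc (∑ (upTo (n + n)) g) _ _ ⟩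
  ∑ (upTo (n + n)) g + (g (n + n) + g (suc (n + n))) ≡⟨ cong (_+ (g (n + n) + g (suc (n + n)))) (∑-upTo-double n g) ⟩
  ∑ (upTo n) h + h n                                ≡⟨ ∑-upTo-∷ʳ n h ⟨
  ∑ (upTo (suc n)) h                                ∎
  where
  open ≡-Reasoning
  h = λ c → g (c + c) + g (suc (c + c))

length-filter : ∀ (p : X → Bool) xs → length (filter (T? ∘ p) xs) ≡ ∑ xs (𝟙 ∘ p)
length-filter p []       = refl
length-filter p (x ∷ xs) with p x
... | true  = cong suc (length-filter p xs)
... | false = length-filter p xs

length-filter-filter : ∀ (p q : X → Bool) xs →
  length (filter (T? ∘ q) (filter (T? ∘ p) xs)) ≡ ∑ xs (λ x → 𝟙 (p x ∧ q x))
length-filter-filter p q []       = refl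
length-filter-filter p q (x ∷ xs) with p x
... | false = length-filter-filter p q xs
... | true with q x
...   | true  = cong suc (length-filter-filter p q xs)
...   | false = length-filter-filter p q xs

∑-𝟙-+-∑-𝟙-not : ∀ (p : X → Bool) xs → ∑ xs (𝟙 ∘ p) + ∑ xs (𝟙 ∘ not ∘ p) ≡ length xs
∑-𝟙-+-∑-𝟙-not p []       = refl
∑-𝟙-+-∑-𝟙-not p (x ∷ xs) with p x
... | true  = cong suc (∑-𝟙-+-∑-𝟙-not p xs)
... | false = trans (+-suc _ _) (cong suc (∑-𝟙-+-∑-𝟙-not p xs))

split-by-𝟙 : ∀ (f : ℕ → ℕ) v b s → v + 𝟙 b ≡ suc s → f v ≡ f s * 𝟙 b + f (suc s) * 𝟙 (not b)
split-by-𝟙 f v true  s v+1≡s+1 rewrite +-comm v 1 | suc-injective v+1≡s+1 = sym (unit (f s) (f (suc s)))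
  where
  unit : ∀ a b → a * 1 + b * 0 ≡ a
  unit = solve-∀
split-by-𝟙 f v false s v≡s+1 rewrite +-identityʳ v | v≡s+1 = sym (unit (f s) (f (suc s)))
  where
  unit : ∀ a b → a * 0 + b * 1 ≡ b
  unit = solve-∀

𝟙-≟-* : ∀ (g : ℕ → ℕ) s k p → g s * 𝟙 (⌊ s ≟ k ⌋ ∧ p) ≡ g k * 𝟙 (⌊ s ≟ k ⌋ ∧ p)
𝟙-≟-* g s k p with s ≟ k
... | yes refl = refl
... | no  _    = trans (*-zeroʳ (g s)) (sym (*-zeroʳ (g k)))

memb⇒∈ : ∀ x ys → T (memb x ys) → x ∈ ys
memb⇒∈ x (y ∷ ys) t with x ≟ y
... | yes x≡y = here x≡y
... | no  _   = there (memb⇒∈ x ys t)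

∈⇒memb : ∀ {x ys} → x ∈ ys → T (memb x ys)
∈⇒memb {x} {y ∷ ys} x∈ with x ≟ y | x∈
... | yes _   | _          = _
... | no  x≢y | here x≡y   = contradiction x≡y x≢y
... | no  _   | there x∈ys = ∈⇒memb x∈ys

memb≡true : ∀ {x ys} → x ∈ ys → memb x ys ≡ true
memb≡true = Equivalence.to T-≡ ∘ ∈⇒memb

memb≡false : ∀ {x ys} → x ∉ ys → memb x ys ≡ false
memb≡false {x} {ys} x∉ys with memb x ys in eq
... | false = refl
... | true  = contradiction (memb⇒∈ x ys (subst T (sym eq) _)) x∉ys

distinct⇔Unique : ∀ {w} → T (distinct w) ⇔ Unique w
distinct⇔Unique = mk⇔ to from
  where
  to : ∀ {w} → T (distinct w) → Unique w
  to {[]}    _ = []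
  to {x ∷ w} t with memb x w in x∈?w
  ... | false = All.¬Any⇒All¬ w (λ x∈w → subst T x∈?w (∈⇒memb x∈w)) ∷ to t
  from : ∀ {w} → Unique w → T (distinct w)
  from {[]}    _ = _
  from {x ∷ w} (x≢w ∷ uw) with memb x w in x∈?w
  ... | false = from uw
  ... | true  = All.All¬⇒¬Any x≢w (memb⇒∈ x w (subst T (sym x∈?w) _))

xor-false⇒≡ : ∀ {a b} → a xor b ≡ false → a ≡ b
xor-false⇒≡ {true}  {true}  _ = refl
xor-false⇒≡ {false} {false} _ = refl

not-xor≡true⇒≡ : ∀ {a b} → not a xor b ≡ true → a ≡ b
not-xor≡true⇒≡ {true}  {true}  _ = refl
not-xor≡true⇒≡ {false} {false} _ = refl

<ᵇ-true : ∀ {m n} → m < n → (m <ᵇ n) ≡ true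
<ᵇ-true = Equivalence.to T-≡ ∘ <⇒<ᵇ

<ᵇ-false : ∀ {m n} → ¬ m < n → (m <ᵇ n) ≡ false
<ᵇ-false {m} {n} m≮n with m <ᵇ n in eq
... | false = refl
... | true  = contradiction (<ᵇ⇒< m n (subst T (sym eq) _)) m≮n

<ᵇ-sucˡ : ∀ a z → z ≢ suc a → (suc a <ᵇ z) ≡ (a <ᵇ z)
<ᵇ-sucˡ zero    zero          _   = refl
<ᵇ-sucˡ zero    (suc zero)    z≢1 = contradiction refl z≢1
<ᵇ-sucˡ zero    (suc (suc z)) _   = refl
<ᵇ-sucˡ (suc a) zero          _   = refl
<ᵇ-sucˡ (suc a) (suc z)       z≢  = <ᵇ-sucˡ a z (z≢ ∘ cong suc)

<ᵇ-sucʳ : ∀ y a → y ≢ a → (y <ᵇ suc a) ≡ (y <ᵇ a)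
<ᵇ-sucʳ zero    zero    y≢a = contradiction refl y≢a
<ᵇ-sucʳ zero    (suc a) _   = refl
<ᵇ-sucʳ (suc y) zero    _   = refl
<ᵇ-sucʳ (suc y) (suc a) y≢a = <ᵇ-sucʳ y a (y≢a ∘ cong suc)

even-+ : ∀ m n → even (m + n) ≡ not (even m) xor even n
even-+ zero    n = refl
even-+ (suc m) n = trans (cong not (even-+ m n)) (not-distribˡ-xor (not (even m)) (even n))

even-double : ∀ m → even (m + m) ≡ true
even-double zero    = refl
even-double (suc m) rewrite +-suc m m | not-involutive (even (m + m)) = even-double m

even-∸ : ∀ {m n} → even m ≡ true → n ≤ m → even (m ∸ n) ≡ even n
even-∸ {m} {n} m-even n≤m =
  not-xor≡true⇒≡ (trans (sym (even-+ (m ∸ n) n)) (trans (cong even (m∸n+n≡m n≤m)) m-even))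

odd⇒positive : ∀ {n} → even n ≡ false → 0 < n
odd⇒positive {suc n} _ = s≤s z≤n

-- Lists without repetitions

map⁺-∈ : ∀ {f : X → Y} {xs} → Unique xs → (∀ {x y} → x ∈ xs → y ∈ xs → f x ≡ f y → x ≡ y) →
         Unique (map f xs)
map⁺-∈ {xs = []}     []           inj = []
map⁺-∈ {xs = x ∷ xs} (x≢xs ∷ uxs) inj =
  All.map⁺ (All.tabulate λ y∈xs fx≡fy → All.lookup x≢xs y∈xs (inj (here refl) (there y∈xs) fx≡fy))
  ∷ map⁺-∈ uxs (λ p q → inj (there p) (there q))

unique∧set⇒↭ : ∀ {xs ys : List X} → Unique xs → Unique ys → (∀ {z} → z ∈ xs ⇔ z ∈ ys) → xs ↭ ys
unique∧set⇒↭ uxs uys xs≈ys = ∼bag⇒↭ (unique∧set⇒bag uxs uys xs≈ys)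

∑-involution : ∀ {xs} {τ : X → X} (f : X → ℕ) → Unique xs → (∀ {x} → x ∈ xs → τ x ∈ xs) →
               (∀ {x} → x ∈ xs → τ (τ x) ≡ x) → ∑ xs (f ∘ τ) ≡ ∑ xs f
∑-involution {xs = xs} {τ} f uxs τ-closed τ-involutive =
  trans (sym (∑-map τ xs f)) (∑-↭ f (unique∧set⇒↭ (map⁺-∈ uxs injective) uxs (mk⇔ to from)))
  where
  injective : ∀ {x y} → x ∈ xs → y ∈ xs → τ x ≡ τ y → x ≡ y
  injective x∈ y∈ τx≡τy = trans (sym (τ-involutive x∈)) (trans (cong τ τx≡τy) (τ-involutive y∈))
  to : ∀ {z} → z ∈ map τ xs → z ∈ xs
  to z∈ with x , x∈ , refl ← ∈-map⁻ τ z∈ = τ-closed x∈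
  from : ∀ {z} → z ∈ xs → z ∈ map τ xs
  from z∈ = subst (_∈ map τ xs) (τ-involutive z∈) (∈-map⁺ τ (τ-closed z∈))

⊆∧length≤⇒⊇ : ∀ {xs ys : List ℕ} → Unique xs → Unique ys → xs ⊆ ys → length ys ≤ length xs → ys ⊆ xs
⊆∧length≤⇒⊇ {xs} {ys} uxs uys xs⊆ys ys≤xs {y} y∈ys with y ∈? xs
... | yes y∈xs = y∈xs
... | no  y∉xs = contradiction ys≤xs (<⇒≱ (begin-strict
  length xs                     ≡⟨ ↭-length xs↭ys∩xs ⟩
  length (filter (_∈? xs) ys)   <⟨ filter-notAll (_∈? xs) ys (Any.map (λ { refl → y∉xs }) y∈ys) ⟩
  length ys                     ∎))
  where
  open ≤-Reasoning
  xs↭ys∩xs : xs ↭ filter (_∈? xs) ys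
  xs↭ys∩xs = unique∧set⇒↭ uxs (Unique.filter⁺ (_∈? xs) {ys} uys)
    (mk⇔ (λ z∈xs → ∈-filter⁺ (_∈? xs) (xs⊆ys z∈xs) z∈xs) (proj₂ ∘ ∈-filter⁻ (_∈? xs) {xs = ys}))

length≡∑-memb : ∀ {P R} → Unique P → Unique R → P ⊆ R → length P ≡ ∑ R (λ y → 𝟙 (memb y P))
length≡∑-memb {P} {R} uP uR P⊆R = trans (↭-length P↭R∩P) (length-filter (λ y → memb y P) R)
  where
  P↭R∩P : P ↭ filter (λ y → T? (memb y P)) R
  P↭R∩P = unique∧set⇒↭ uP (Unique.filter⁺ (λ y → T? (memb y P)) uR)
    (mk⇔ (λ y∈P → ∈-filter⁺ (λ y → T? (memb y P)) (P⊆R y∈P) (∈⇒memb y∈P))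
         (λ y∈ → memb⇒∈ _ P (proj₂ (∈-filter⁻ (λ y → T? (memb y P)) {xs = R} y∈))))

∈-take⁻ : ∀ {z : X} i xs → z ∈ take i xs → z ∈ xs
∈-take⁻ i xs = subst (_ ∈_) (take++drop≡id i xs) ∘ ∈-++⁺ˡ

++-disjoint : ∀ {u v : List X} {z} → Unique (u ++ v) → z ∈ u → z ∉ v
++-disjoint {u = y ∷ u} (y≢ ∷ _)  (here refl) z∈v = All.lookup y≢ (∈-++⁺ʳ u z∈v) refl
++-disjoint {u = y ∷ u} (_ ∷ uuv) (there z∈u) z∈v = ++-disjoint uuv z∈u z∈v

∈-drop⇒∉-take : ∀ {z : X} i {w} → Unique w → z ∈ drop i w → z ∉ take i w
∈-drop⇒∉-take i {w} uw z∈drop z∈take =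
  ++-disjoint (subst Unique (sym (take++drop≡id i w)) uw) z∈take z∈drop

++-∷-cancel : ∀ {x : X} {u v u′ v′} → x ∉ u → x ∉ u′ → u ++ x ∷ v ≡ u′ ++ x ∷ v′ → u ≡ u′ × v ≡ v′
++-∷-cancel {u = []}    {u′ = []}      _   _    eq = refl , ∷-injectiveʳ eq
++-∷-cancel {u = []}    {u′ = y ∷ u′}  _   x∉u′ eq = contradiction (here (∷-injectiveˡ eq)) x∉u′
++-∷-cancel {u = y ∷ u} {u′ = []}      x∉u _    eq = contradiction (here (sym (∷-injectiveˡ eq))) x∉u
++-∷-cancel {u = y ∷ u} {u′ = y′ ∷ u′} x∉u x∉u′ eq =
  let y≡y′ , rest = ∷-injective eq
      u≡u′ , v≡v′ = ++-∷-cancel (x∉u ∘ there) (x∉u′ ∘ there) rest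
  in cong₂ _∷_ y≡y′ u≡u′ , v≡v′

concatMap-map≡cartesianProductWith : ∀ {Z : Set} (f : X → Y → Z) xs ys →
  concatMap (λ x → map (f x) ys) xs ≡ cartesianProductWith f xs ys
concatMap-map≡cartesianProductWith f []       ys = refl
concatMap-map≡cartesianProductWith f (x ∷ xs) ys =
  cong (map (f x) ys ++_) (concatMap-map≡cartesianProductWith f xs ys)

-- Permutations of [m]

Letter : ℕ → ℕ → Set
Letter m y = 0 < y × y ≤ m

prepend : List ℕ → ℕ → List ℕ
prepend w a = suc a ∷ w

words-suc : ∀ m len → words m (suc len) ≡ cartesianProductWith prepend (words m len) (upTo m)
words-suc m len = concatMap-map≡cartesianProductWith prepend (words m len) (upTo m)

∈-words⁻ : ∀ m len {w} → w ∈ words m len → length w ≡ len × All (Letter m) w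
∈-words⁻ m zero    (here refl) = refl , []
∈-words⁻ m (suc len) w∈
  with w′ , a , w′∈ , a∈ , refl ←
       ∈-cartesianProductWith⁻ prepend (words m len) (upTo m) (subst (_ ∈_) (words-suc m len) w∈) =
  let len≡ , letters = ∈-words⁻ m len w′∈ in cong suc len≡ , (s≤s z≤n , ∈-upTo⁻ a∈) ∷ letters

∈-words⁺ : ∀ m {w} → All (Letter m) w → w ∈ words m (length w)
∈-words⁺ m []                           = here refl
∈-words⁺ m {suc a ∷ w} ((_ , a<m) ∷ letters) =
  subst (_ ∈_) (sym (words-suc m (length w))) (∈-cartesianProductWith⁺ prepend (∈-words⁺ m letters) (∈-upTo⁺ a<m))

words-unique : ∀ m len → Unique (words m len)
words-unique m zero      = [] ∷ []
words-unique m (suc len) = subst Unique (sym (words-suc m len))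
  (Unique.cartesianProductWith⁺ prepend prepend-injective (words-unique m len) (Unique.upTo⁺ m))
  where
  prepend-injective : ∀ {w w′ a b} → prepend w a ≡ prepend w′ b → w ≡ w′ × a ≡ b
  prepend-injective eq = let a≡b , w≡w′ = ∷-injective eq in w≡w′ , suc-injective a≡b

record IsPermutation (m : ℕ) (w : List ℕ) : Set where
  constructor isPermutation
  field
    length≡ : length w ≡ m
    unique  : Unique w
    letters : All (Letter m) w

∈-perms⁻ : ∀ {m w} → w ∈ perms m → IsPermutation m w
∈-perms⁻ {m} w∈ with w∈words , t ← ∈-filter⁻ (T? ∘ distinct) w∈ =
  let len≡ , letters = ∈-words⁻ m m w∈words in isPermutation len≡ (Equivalence.to distinct⇔Unique t) letters

∈-perms⁺ : ∀ {m w} → IsPermutation m w → w ∈ perms m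
∈-perms⁺ {m} (isPermutation refl uw letters) =
  ∈-filter⁺ (T? ∘ distinct) (∈-words⁺ m letters) (Equivalence.from distinct⇔Unique uw)

perms-unique : ∀ m → Unique (perms m)
perms-unique m = Unique.filter⁺ (T? ∘ distinct) (words-unique m m)

IsPermutation-resp-↭ : ∀ {m w w′} → w ↭ w′ → IsPermutation m w → IsPermutation m w′
IsPermutation-resp-↭ w↭w′ (isPermutation len≡ uw letters) =
  isPermutation (trans (sym (↭-length w↭w′)) len≡) (Unique-resp-↭ (↭⇒↭ₛ w↭w′) uw) (All-resp-↭ w↭w′ letters)

letter⇒∈ : ∀ {m y} → Letter m y → y ∈ map suc (upTo m)
letter⇒∈ {y = suc a} (_ , a<m) = ∈-map⁺ suc (∈-upTo⁺ a<m)

IsPermutation⇒letter⇒∈ : ∀ {m w y} → IsPermutation m w → Letter m y → y ∈ w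
IsPermutation⇒letter⇒∈ {m} {w} (isPermutation len≡ uw letters) =
  ⊆∧length≤⇒⊇ uw (Unique.map⁺ suc-injective (Unique.upTo⁺ m)) (letter⇒∈ ∘ All.lookup letters) length≤
  ∘ letter⇒∈
  where
  length≤ : length (map suc (upTo m)) ≤ length w
  length≤ = ≤-reflexive (trans (length-map suc (upTo m)) (trans (length-upTo m) (sym len≡)))

IsPermutation⇒<suc : ∀ {m w} → IsPermutation m w → All (_< suc m) w
IsPermutation⇒<suc (isPermutation _ _ letters) = All.map (λ (_ , y≤m) → s≤s y≤m) letters

IsPermutation⇒suc∉ : ∀ {m w} → IsPermutation m w → suc m ∉ w
IsPermutation⇒suc∉ (isPermutation _ _ letters) m+1∈w = 1+n≰n (proj₂ (All.lookup letters m+1∈w))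

∷-IsPermutation⁺ : ∀ {m w} → IsPermutation m w → IsPermutation (suc m) (suc m ∷ w)
∷-IsPermutation⁺ {m} σ@(isPermutation len≡ uw letters) =
  isPermutation (cong suc len≡) (All.¬Any⇒All¬ _ (IsPermutation⇒suc∉ σ) ∷ uw)
    ((s≤s z≤n , ≤-refl) ∷ All.map (λ (0<y , y≤m) → 0<y , m≤n⇒m≤1+n y≤m) letters)

∷-IsPermutation⁻ : ∀ {m w} → IsPermutation (suc m) (suc m ∷ w) → IsPermutation m w
∷-IsPermutation⁻ {m} (isPermutation len≡ (m+1≢w ∷ uw) (_ ∷ letters)) =
  isPermutation (suc-injective len≡) uw
    (All.zipWith (λ ((0<y , y≤m+1) , m+1≢y) → 0<y , ≤-pred (≤∧≢⇒< y≤m+1 (m+1≢y ∘ sym))) (letters , m+1≢w))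

-- Inserting the largest letter

insert : ℕ → ℕ → List ℕ → List ℕ
insert x i σ = take i σ ++ x ∷ drop i σ

insert-↭ : ∀ x i σ → insert x i σ ↭ x ∷ σ
insert-↭ x i σ = ↭-trans (shift x (take i σ) (drop i σ)) (↭-prep x (↭-reflexive (take++drop≡id i σ)))

insert-length : ∀ x u v → insert x (length u) (u ++ v) ≡ u ++ x ∷ v
insert-length x []      v = refl
insert-length x (y ∷ u) v = cong (y ∷_) (insert-length x u v)

insert-at-end : ∀ x σ → insert x (length σ) σ ≡ σ ++ [ x ]
insert-at-end x []      = refl
insert-at-end x (y ∷ σ) = cong (y ∷_) (insert-at-end x σ)

insert-injective : ∀ {x i j σ σ′} → x ∉ σ → x ∉ σ′ → i ≤ length σ → j ≤ length σ′ →
                   insert x i σ ≡ insert x j σ′ → σ ≡ σ′ × i ≡ j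
insert-injective {x} {i} {j} {σ} {σ′} x∉σ x∉σ′ i≤ j≤ eq =
  let take≡ , drop≡ = ++-∷-cancel (x∉σ ∘ ∈-take⁻ i σ) (x∉σ′ ∘ ∈-take⁻ j σ′) eq in
  trans (sym (take++drop≡id i σ)) (trans (cong₂ _++_ take≡ drop≡) (take++drop≡id j σ′)) ,
  trans (sym (length-take-≤ i σ i≤)) (trans (cong length take≡) (length-take-≤ j σ′ j≤))
  where
  length-take-≤ : ∀ k (τ : List ℕ) → k ≤ length τ → length (take k τ) ≡ k
  length-take-≤ k τ k≤ = trans (length-take k τ) (m≤n⇒m⊓n≡m k≤)

insertions : ℕ → List (List ℕ × ℕ) → List (List ℕ)
insertions x = map (λ (σ , i) → insert x i σ)

perms-suc-↭ : ∀ N → perms (suc N) ↭ insertions (suc N) (cartesianProduct (perms N) (upTo (suc N)))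
perms-suc-↭ N = unique∧set⇒↭ (perms-unique (suc N))
  (map⁺-∈ (Unique.cartesianProduct⁺ (perms-unique N) (Unique.upTo⁺ (suc N))) injective) (mk⇔ to from)
  where
  x = suc N
  pairs = cartesianProduct (perms N) (upTo (suc N))
  injective : ∀ {p q} → p ∈ pairs → q ∈ pairs →
              insert x (proj₂ p) (proj₁ p) ≡ insert x (proj₂ q) (proj₁ q) → p ≡ q
  injective {σ , i} {σ′ , j} p∈ q∈ eq =
    let σ∈ , i∈ = ∈-cartesianProduct⁻ (perms N) (upTo (suc N)) p∈
        σ′∈ , j∈ = ∈-cartesianProduct⁻ (perms N) (upTo (suc N)) q∈
        Pσ = ∈-perms⁻ σ∈
        Pσ′ = ∈-perms⁻ σ′∈
        σ≡σ′ , i≡j = insert-injective (IsPermutation⇒suc∉ Pσ) (IsPermutation⇒suc∉ Pσ′)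
          (subst (_ ≤_) (sym (IsPermutation.length≡ Pσ)) (≤-pred (∈-upTo⁻ i∈)))
          (subst (_ ≤_) (sym (IsPermutation.length≡ Pσ′)) (≤-pred (∈-upTo⁻ j∈))) eq
    in cong₂ _,_ σ≡σ′ i≡j
  to : ∀ {w} → w ∈ perms (suc N) → w ∈ insertions x pairs
  to {w} w∈ with u , v , refl ← ∈-∃++ (IsPermutation⇒letter⇒∈ {y = x} (∈-perms⁻ w∈) (s≤s z≤n , ≤-refl)) =
    subst (_∈ insertions x pairs) (insert-length x u v)
      (∈-map⁺ (λ (σ , i) → insert x i σ) (∈-cartesianProduct⁺ (∈-perms⁺ Pσ) (∈-upTo⁺ u<)))
    where
    Pw = ∈-perms⁻ w∈
    Pσ : IsPermutation N (u ++ v)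
    Pσ = ∷-IsPermutation⁻ (IsPermutation-resp-↭ (shift x u v) Pw)
    u< : length u < suc N
    u< = subst (length u <_) (trans (sym (length-++ u)) (IsPermutation.length≡ Pw))
           (m<m+n (length u) (s≤s z≤n))
  from : ∀ {w} → w ∈ insertions x pairs → w ∈ perms (suc N)
  from w∈ with (σ , i) , p∈ , refl ← ∈-map⁻ (λ (σ , i) → insert x i σ) w∈ =
    ∈-perms⁺ (IsPermutation-resp-↭ (↭-sym (insert-↭ x i σ))
      (∷-IsPermutation⁺ (∈-perms⁻ (proj₁ (∈-cartesianProduct⁻ (perms N) (upTo (suc N)) p∈)))))

∑-perms-suc : ∀ N (f : List ℕ → ℕ) →
  ∑ (perms (suc N)) f ≡ ∑ (perms N) (λ σ → ∑ (upTo (suc N)) (λ i → f (insert (suc N) i σ)))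
∑-perms-suc N f = begin
  ∑ (perms (suc N)) f                                       ≡⟨ ∑-↭ f (perms-suc-↭ N) ⟩
  ∑ (insertions (suc N) pairs) f                            ≡⟨ ∑-map (λ (σ , i) → insert (suc N) i σ) pairs f ⟩
  ∑ pairs (λ (σ , i) → f (insert (suc N) i σ))              ≡⟨ ∑-cartesianProduct (perms N) (upTo (suc N)) _ ⟩
  ∑ (perms N) (λ σ → ∑ (upTo (suc N)) (λ i → f (insert (suc N) i σ))) ∎
  where
  open ≡-Reasoning
  pairs = cartesianProduct (perms N) (upTo (suc N))

ascents-∷-max : ∀ {x} σ → All (_< x) σ → ascents (x ∷ σ) ≡ ascents σ
ascents-∷-max {x} []      []        = refl
ascents-∷-max {x} (y ∷ σ) (y<x ∷ _) rewrite <ᵇ-false (<⇒≯ y<x) = refl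

ascents-++-peak : ∀ {x} y u v → All (_< x) (y ∷ u) → All (_< x) v →
                  ascents ((y ∷ u) ++ x ∷ v) ≡ suc (ascents (y ∷ u) + ascents v)
ascents-++-peak y []       v (y<x ∷ []) v<x rewrite <ᵇ-true y<x = cong suc (ascents-∷-max _ v<x)
ascents-++-peak y (z ∷ u)  v (_ ∷ zu<x) v<x = begin
  𝟙 (y <ᵇ z) + ascents ((z ∷ u) ++ _ ∷ v)          ≡⟨ cong (𝟙 (y <ᵇ z) +_) (ascents-++-peak z u v zu<x v<x) ⟩
  𝟙 (y <ᵇ z) + suc (ascents (z ∷ u) + ascents v)  ≡⟨ +-suc _ _ ⟩
  suc (𝟙 (y <ᵇ z) + (ascents (z ∷ u) + ascents v)) ≡⟨ cong suc (+-assoc (𝟙 (y <ᵇ z)) _ _) ⟨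
  suc (ascents (y ∷ z ∷ u) + ascents v)            ∎
  where open ≡-Reasoning

ascents-insert-inner : ∀ {x} i y σ → All (_< x) (y ∷ σ) →
  ascents (insert x (suc i) (y ∷ σ)) ≡ suc (ascents (take (suc i) (y ∷ σ)) + ascents (drop (suc i) (y ∷ σ)))
ascents-insert-inner i y σ (y<x ∷ σ<x) =
  ascents-++-peak y (take i σ) (drop i σ) (y<x ∷ All.take⁺ i σ<x) (All.drop⁺ i σ<x)

ascentAt : List ℕ → ℕ → Bool
ascentAt (y ∷ z ∷ w) zero    = y <ᵇ z
ascentAt (y ∷ w)     (suc i) = ascentAt w i
ascentAt _           _       = false

∑-ascentAt : ∀ y w → ∑ (upTo (length w)) (𝟙 ∘ ascentAt (y ∷ w)) ≡ ascents (y ∷ w)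
∑-ascentAt y []      = refl
∑-ascentAt y (z ∷ w) =
  trans (∑-upTo-suc (length w) (𝟙 ∘ ascentAt (y ∷ z ∷ w))) (cong (𝟙 (y <ᵇ z) +_) (∑-ascentAt z w))

ascents-insert-gap : ∀ {x} i σ → All (_< x) σ → suc (suc i) ≤ length σ →
                     ascents (insert x (suc i) σ) + 𝟙 (ascentAt σ i) ≡ suc (ascents σ)
ascents-insert-gap zero (y ∷ z ∷ σ) (y<x ∷ z<x ∷ _) _
  rewrite <ᵇ-true y<x | <ᵇ-false (<⇒≯ z<x) = cong suc (+-comm (ascents (z ∷ σ)) (𝟙 (y <ᵇ z)))
ascents-insert-gap zero (y ∷ []) _ (s≤s ())
ascents-insert-gap (suc i) (y ∷ z ∷ σ) (_ ∷ zσ<x) (s≤s ssi≤) = begin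
  𝟙 (y <ᵇ z) + ascents (insert _ (suc i) (z ∷ σ)) + 𝟙 (ascentAt (z ∷ σ) i)
    ≡⟨ +-assoc (𝟙 (y <ᵇ z)) _ _ ⟩
  𝟙 (y <ᵇ z) + (ascents (insert _ (suc i) (z ∷ σ)) + 𝟙 (ascentAt (z ∷ σ) i))
    ≡⟨ cong (𝟙 (y <ᵇ z) +_) (ascents-insert-gap i (z ∷ σ) zσ<x ssi≤) ⟩
  𝟙 (y <ᵇ z) + suc (ascents (z ∷ σ))
    ≡⟨ +-suc _ _ ⟩
  suc (ascents (y ∷ z ∷ σ)) ∎
  where open ≡-Reasoning

ascents-≤-length : ∀ y σ → ascents (y ∷ σ) ≤ length σ
ascents-≤-length y []      = z≤n
ascents-≤-length y (z ∷ σ) with y <ᵇ z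
... | true  = s≤s (ascents-≤-length z σ)
... | false = m≤n⇒m≤1+n (ascents-≤-length z σ)

∑-ascents-insert-gaps : ∀ {x} y σ (f : ℕ → ℕ) → All (_< x) (y ∷ σ) →
  let s = ascents (y ∷ σ) in
  ∑ (upTo (length σ)) (λ i → f (ascents (insert x (suc i) (y ∷ σ)))) ≡ f s * s + f (suc s) * (length σ ∸ s)
∑-ascents-insert-gaps {x} y σ f yσ<x = begin
  ∑ gaps (λ i → f (ascents (insert x (suc i) (y ∷ σ))))
    ≡⟨ ∑-cong (λ {i} i∈ → split-by-𝟙 f _ (c i) s (ascents-insert-gap i (y ∷ σ) yσ<x (s≤s (∈-upTo⁻ i∈)))) ⟩
  ∑ gaps (λ i → f s * 𝟙 (c i) + f (suc s) * 𝟙 (not (c i)))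
    ≡⟨ ∑-+ gaps _ _ ⟩
  ∑ gaps (λ i → f s * 𝟙 (c i)) + ∑ gaps (λ i → f (suc s) * 𝟙 (not (c i)))
    ≡⟨ cong₂ _+_ (∑-*ˡ (f s) gaps (𝟙 ∘ c)) (∑-*ˡ (f (suc s)) gaps (𝟙 ∘ not ∘ c)) ⟩
  f s * ∑ gaps (𝟙 ∘ c) + f (suc s) * ∑ gaps (𝟙 ∘ not ∘ c)
    ≡⟨ cong₂ (λ a b → f s * a + f (suc s) * b) (∑-ascentAt y σ) #descents ⟩
  f s * s + f (suc s) * (length σ ∸ s) ∎
  where
  open ≡-Reasoning
  gaps = upTo (length σ)
  s = ascents (y ∷ σ)
  c = ascentAt (y ∷ σ)
  #descents : ∑ gaps (𝟙 ∘ not ∘ c) ≡ length σ ∸ s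
  #descents = begin
    ∑ gaps (𝟙 ∘ not ∘ c)                                    ≡⟨ m+n∸m≡n (∑ gaps (𝟙 ∘ c)) _ ⟨
    ∑ gaps (𝟙 ∘ c) + ∑ gaps (𝟙 ∘ not ∘ c) ∸ ∑ gaps (𝟙 ∘ c)
      ≡⟨ cong₂ _∸_ (trans (∑-𝟙-+-∑-𝟙-not c gaps) (length-upTo (length σ))) (∑-ascentAt y σ) ⟩
    length σ ∸ s                                             ∎

∑-ascents-insert : ∀ {x} σ (f : ℕ → ℕ) → All (_< x) σ →
  let s = ascents σ in
  ∑ (upTo (suc (length σ))) (λ i → f (ascents (insert x i σ))) ≡ suc s * f s + (length σ ∸ s) * f (suc s)
∑-ascents-insert     []      f []   = sym (+-identityʳ (f 0 + 0))
∑-ascents-insert {x} (y ∷ σ) f yσ<x = begin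
  ∑ (upTo (suc (suc (length σ)))) g
    ≡⟨ ∑-upTo-suc (suc (length σ)) g ⟩
  g 0 + ∑ (upTo (suc (length σ))) (g ∘ suc)
    ≡⟨ cong (g 0 +_) (∑-upTo-∷ʳ (length σ) (g ∘ suc)) ⟩
  g 0 + (∑ (upTo (length σ)) (g ∘ suc) + g (suc (length σ)))
    ≡⟨ cong₂ (λ a b → a + (∑ (upTo (length σ)) (g ∘ suc) + b)) first last ⟩
  f s + (∑ (upTo (length σ)) (g ∘ suc) + f (suc s))
    ≡⟨ cong (λ a → f s + (a + f (suc s))) (∑-ascents-insert-gaps y σ f yσ<x) ⟩
  f s + (f s * s + f (suc s) * (length σ ∸ s) + f (suc s))
    ≡⟨ regroup (f s) (f (suc s)) s (length σ ∸ s) ⟩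
  suc s * f s + suc (length σ ∸ s) * f (suc s)
    ≡⟨ cong (λ a → suc s * f s + a * f (suc s)) (+-∸-assoc 1 (ascents-≤-length y σ)) ⟨
  suc s * f s + (suc (length σ) ∸ s) * f (suc s) ∎
  where
  open ≡-Reasoning
  s = ascents (y ∷ σ)
  g = λ i → f (ascents (insert x i (y ∷ σ)))
  first : g 0 ≡ f s
  first = cong f (ascents-∷-max (y ∷ σ) yσ<x)
  last : g (suc (length σ)) ≡ f (suc s)
  last = cong f (begin
    ascents (insert x (length (y ∷ σ)) (y ∷ σ)) ≡⟨ cong ascents (insert-at-end x (y ∷ σ)) ⟩
    ascents ((y ∷ σ) ++ [ x ])                  ≡⟨ ascents-++-peak y σ [] yσ<x [] ⟩
    suc (s + 0)                                 ≡⟨ cong suc (+-identityʳ s) ⟩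
    suc s                                       ∎)
  regroup : ∀ a b s t → a + (a * s + b * t + b) ≡ suc s * a + suc t * b
  regroup = solve-∀

∑-insert-ascents≟ : ∀ {N σ} k p → IsPermutation N σ →
  ∑ (upTo (suc N)) (λ i → 𝟙 (⌊ ascents (insert (suc N) i σ) ≟ k ⌋ ∧ p)) ≡
  suc k * 𝟙 (⌊ ascents σ ≟ k ⌋ ∧ p) + (suc N ∸ k) * 𝟙 (⌊ suc (ascents σ) ≟ k ⌋ ∧ p)
∑-insert-ascents≟ {N} {σ} k p Pσ@(isPermutation len≡ _ _) = begin
  ∑ (upTo (suc N)) (λ i → f (ascents (insert (suc N) i σ)))
    ≡⟨ cong (λ L → ∑ (upTo (suc L)) (λ i → f (ascents (insert (suc N) i σ)))) len≡ ⟨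
  ∑ (upTo (suc (length σ))) (λ i → f (ascents (insert (suc N) i σ)))
    ≡⟨ ∑-ascents-insert σ f (IsPermutation⇒<suc Pσ) ⟩
  suc s * f s + (length σ ∸ s) * f (suc s)
    ≡⟨ cong (λ L → suc s * f s + (suc L ∸ suc s) * f (suc s)) len≡ ⟩
  suc s * f s + (suc N ∸ suc s) * f (suc s)
    ≡⟨ cong₂ _+_ (𝟙-≟-* suc s k p) (𝟙-≟-* (suc N ∸_) (suc s) k p) ⟩
  suc k * f s + (suc N ∸ k) * f (suc s) ∎
  where
  open ≡-Reasoning
  s = ascents σ
  f = λ a → 𝟙 (⌊ a ≟ k ⌋ ∧ p)

countSmaller-++-∷-larger : ∀ {x y} u v → y < x → countSmaller y (u ++ x ∷ v) ≡ countSmaller y (u ++ v)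
countSmaller-++-∷-larger []      v y<x rewrite <ᵇ-false (<⇒≯ y<x) = refl
countSmaller-++-∷-larger {y = y} (z ∷ u) v y<x = cong (𝟙 (z <ᵇ y) +_) (countSmaller-++-∷-larger u v y<x)

countSmaller-max : ∀ {x} v → All (_< x) v → countSmaller x v ≡ length v
countSmaller-max []      []          = refl
countSmaller-max (y ∷ v) (y<x ∷ v<x) rewrite <ᵇ-true y<x = cong suc (countSmaller-max v v<x)

inversions-++-peak : ∀ {x} u v → All (_< x) (u ++ v) → inversions (u ++ x ∷ v) ≡ length v + inversions (u ++ v)
inversions-++-peak []      v v<x           = cong (_+ inversions v) (countSmaller-max v v<x)
inversions-++-peak (y ∷ u) v (y<x ∷ uv<x) = begin
  countSmaller y (u ++ _ ∷ v) + inversions (u ++ _ ∷ v)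
    ≡⟨ cong₂ _+_ (countSmaller-++-∷-larger u v y<x) (inversions-++-peak u v uv<x) ⟩
  countSmaller y (u ++ v) + (length v + inversions (u ++ v))
    ≡⟨ x∙yz≈y∙xz (countSmaller y (u ++ v)) (length v) _ ⟩
  length v + (countSmaller y (u ++ v) + inversions (u ++ v)) ∎
  where open ≡-Reasoning

inversions-insert : ∀ {x} i σ → All (_< x) σ → inversions (insert x i σ) ≡ (length σ ∸ i) + inversions σ
inversions-insert {x} i σ σ<x =
  trans (inversions-++-peak (take i σ) (drop i σ) (subst (All (_< x)) (sym (take++drop≡id i σ)) σ<x))
        (cong₂ _+_ (length-drop i σ) (cong inversions (take++drop≡id i σ)))

-- Exchanging the values a and a + 1

swapAdj : ℕ → ℕ → ℕ
swapAdj a y = if ⌊ y ≟ a ⌋ then suc a else if ⌊ y ≟ suc a ⌋ then a else y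

data SwapAdj (a : ℕ) : ℕ → ℕ → Set where
  low   : SwapAdj a a (suc a)
  high  : SwapAdj a (suc a) a
  fixed : ∀ {y} → y ≢ a → y ≢ suc a → SwapAdj a y y

swapAdj-view : ∀ a y → SwapAdj a y (swapAdj a y)
swapAdj-view a y with y ≟ a | y ≟ suc a
... | yes refl | _        = low
... | no  y≢a  | yes refl = high
... | no  y≢a  | no y≢a+1 = fixed y≢a y≢a+1

swapAdj-low : ∀ a → swapAdj a a ≡ suc a
swapAdj-low a with swapAdj a a | swapAdj-view a a
... | _ | low         = refl
... | _ | fixed a≢a _ = contradiction refl a≢a

swapAdj-high : ∀ a → swapAdj a (suc a) ≡ a
swapAdj-high a with swapAdj a (suc a) | swapAdj-view a (suc a)
... | _ | high            = refl
... | _ | fixed _ a+1≢a+1 = contradiction refl a+1≢a+1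

swapAdj-fixed : ∀ {a y} → y ≢ a → y ≢ suc a → swapAdj a y ≡ y
swapAdj-fixed {a} {y} y≢a y≢a+1 with swapAdj a y | swapAdj-view a y
... | _ | low       = contradiction refl y≢a
... | _ | high      = contradiction refl y≢a+1
... | _ | fixed _ _ = refl

swapAdj-involutive : ∀ a y → swapAdj a (swapAdj a y) ≡ y
swapAdj-involutive a y with swapAdj a y | swapAdj-view a y
... | _ | low             = swapAdj-high a
... | _ | high            = swapAdj-low a
... | _ | fixed y≢a y≢a+1 = swapAdj-fixed y≢a y≢a+1

swapAdj-IsPermutation : ∀ {m a σ} → 0 < a → suc a ≤ m → IsPermutation m σ → IsPermutation m (map (swapAdj a) σ)
swapAdj-IsPermutation {m} {a} {σ} 0<a a+1≤m (isPermutation len≡ uσ letters) =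
  isPermutation (trans (length-map (swapAdj a) σ) len≡) (Unique.map⁺ injective uσ) (All.map⁺ (All.map letter letters))
  where
  injective : ∀ {y z} → swapAdj a y ≡ swapAdj a z → y ≡ z
  injective {y} {z} eq = trans (sym (swapAdj-involutive a y)) (trans (cong (swapAdj a) eq) (swapAdj-involutive a z))
  letter : ∀ {y} → Letter m y → Letter m (swapAdj a y)
  letter {y} y-letter with swapAdj a y | swapAdj-view a y
  ... | _ | low       = s≤s z≤n , a+1≤m
  ... | _ | high      = 0<a , <⇒≤ a+1≤m
  ... | _ | fixed _ _ = y-letter

memb-map-swapAdj : ∀ a v P → memb v (map (swapAdj a) P) ≡ memb (swapAdj a v) P
memb-map-swapAdj a v []      = refl
memb-map-swapAdj a v (y ∷ P) with v ≟ swapAdj a y | swapAdj a v ≟ y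
... | yes _    | yes _    = refl
... | no  _    | no  _    = memb-map-swapAdj a v P
... | yes refl | no  ≢y   = contradiction (swapAdj-involutive a y) ≢y
... | no  v≢   | yes refl = contradiction (sym (swapAdj-involutive a v)) v≢

IsPair : ℕ → ℕ → ℕ → Set
IsPair a y z = (y ≡ a × z ≡ suc a) ⊎ (y ≡ suc a × z ≡ a)

¬both⇒¬IsPair : ∀ {a P y z} → ¬ (a ∈ P × suc a ∈ P) → y ∈ P → z ∈ P → ¬ IsPair a y z
¬both⇒¬IsPair ¬both y∈ z∈ (inj₁ (refl , refl)) = ¬both (y∈ , z∈)
¬both⇒¬IsPair ¬both y∈ z∈ (inj₂ (refl , refl)) = ¬both (z∈ , y∈)

swapAdj-<ᵇ : ∀ a y z → ¬ IsPair a y z → (swapAdj a y <ᵇ swapAdj a z) ≡ (y <ᵇ z)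
swapAdj-<ᵇ a y z ¬pair with swapAdj a y | swapAdj-view a y | swapAdj a z | swapAdj-view a z
... | _ | low         | _ | low           = refl
... | _ | low         | _ | high          = contradiction (inj₁ (refl , refl)) ¬pair
... | _ | low         | _ | fixed _ z≢a+1 = <ᵇ-sucˡ a z z≢a+1
... | _ | high        | _ | low           = contradiction (inj₂ (refl , refl)) ¬pair
... | _ | high        | _ | high          = refl
... | _ | high        | _ | fixed _ z≢a+1 = sym (<ᵇ-sucˡ a z z≢a+1)
... | _ | fixed y≢a _ | _ | low           = <ᵇ-sucʳ y a y≢a
... | _ | fixed y≢a _ | _ | high          = sym (<ᵇ-sucʳ y a y≢a)
... | _ | fixed _ _   | _ | fixed _ _     = refl

ascents-swapAdj : ∀ a P → ¬ (a ∈ P × suc a ∈ P) → ascents (map (swapAdj a) P) ≡ ascents P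
ascents-swapAdj a []          _     = refl
ascents-swapAdj a (y ∷ [])    _     = refl
ascents-swapAdj a (y ∷ z ∷ P) ¬both =
  cong₂ _+_ (cong 𝟙 (swapAdj-<ᵇ a y z (¬both⇒¬IsPair ¬both (here refl) (there (here refl)))))
            (ascents-swapAdj a (z ∷ P) (λ (a∈ , a+1∈) → ¬both (there a∈ , there a+1∈)))

countSmaller-swapAdj : ∀ a y P → (∀ {t} → t ∈ P → ¬ IsPair a t y) →
                       countSmaller (swapAdj a y) (map (swapAdj a) P) ≡ countSmaller y P
countSmaller-swapAdj a y []      _      = refl
countSmaller-swapAdj a y (t ∷ P) ¬pair =
  cong₂ _+_ (cong 𝟙 (swapAdj-<ᵇ a t y (¬pair (here refl)))) (countSmaller-swapAdj a y P (¬pair ∘ there))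

inversions-swapAdj : ∀ a P → ¬ (a ∈ P × suc a ∈ P) → inversions (map (swapAdj a) P) ≡ inversions P
inversions-swapAdj a []      _     = refl
inversions-swapAdj a (y ∷ P) ¬both =
  cong₂ _+_ (countSmaller-swapAdj a y P (λ t∈ → ¬both⇒¬IsPair ¬both (there t∈) (here refl)))
            (inversions-swapAdj a P (λ (a∈ , a+1∈) → ¬both (there a∈ , there a+1∈)))

countSmaller-swapAdj-low : ∀ a P → a ∉ P → suc a ∈ P → Unique P →
                           countSmaller (suc a) (map (swapAdj a) P) ≡ suc (countSmaller a P)
countSmaller-swapAdj-low a (t ∷ P) a∉ a+1∈ (t≢P ∷ uP) with swapAdj a t | swapAdj-view a t
... | _ | low  = contradiction (here refl) a∉
... | _ | high rewrite <ᵇ-true (n<1+n a) | <ᵇ-false (<-asym (n<1+n a)) =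
  cong suc (trans (cong (λ v → countSmaller v (map (swapAdj a) P)) (sym (swapAdj-low a)))
                  (countSmaller-swapAdj a a P ¬pair))
  where
  ¬pair : ∀ {u} → u ∈ P → ¬ IsPair a u a
  ¬pair u∈ (inj₁ (_ , a≡a+1))  = <⇒≢ (n<1+n a) a≡a+1
  ¬pair u∈ (inj₂ (refl , _))  = All.lookup t≢P u∈ refl
... | _ | fixed t≢a t≢a+1 rewrite <ᵇ-sucʳ t a t≢a =
  trans (cong (𝟙 (t <ᵇ a) +_) (countSmaller-swapAdj-low a P (a∉ ∘ there) (Any.tail (t≢a+1 ∘ sym) a+1∈) uP))
        (+-suc _ _)

countSmaller-swapAdj-high : ∀ a P → suc a ∉ P → a ∈ P → Unique P →
                            suc (countSmaller a (map (swapAdj a) P)) ≡ countSmaller (suc a) P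
countSmaller-swapAdj-high a (t ∷ P) a+1∉ a∈ (t≢P ∷ uP) with swapAdj a t | swapAdj-view a t
... | _ | high = contradiction (here refl) a+1∉
... | _ | low rewrite <ᵇ-false (<-asym (n<1+n a)) | <ᵇ-true (n<1+n a) =
  cong suc (trans (cong (λ v → countSmaller v (map (swapAdj a) P)) (sym (swapAdj-high a)))
                  (countSmaller-swapAdj a (suc a) P ¬pair))
  where
  ¬pair : ∀ {u} → u ∈ P → ¬ IsPair a u (suc a)
  ¬pair u∈ (inj₁ (refl , _))  = All.lookup t≢P u∈ refl
  ¬pair u∈ (inj₂ (_ , a+1≡a)) = <⇒≢ (n<1+n a) (sym a+1≡a)
... | _ | fixed t≢a t≢a+1 rewrite <ᵇ-sucʳ t a t≢a =
  trans (sym (+-suc _ _))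
        (cong (𝟙 (t <ᵇ a) +_) (countSmaller-swapAdj-high a P (a+1∉ ∘ there) (Any.tail (t≢a ∘ sym) a∈) uP))

inversions-swapAdj-parity : ∀ a w → Unique w → a ∈ w → suc a ∈ w →
                            even (inversions (map (swapAdj a) w)) ≡ not (even (inversions w))
inversions-swapAdj-parity a (t ∷ w) (t≢w ∷ uw) a∈ a+1∈ with swapAdj a t | swapAdj-view a t
... | _ | low = cong even (cong₂ _+_
        (countSmaller-swapAdj-low a w a∉w (Any.tail (<⇒≢ (n<1+n a) ∘ sym) a+1∈) uw)
        (inversions-swapAdj a w (a∉w ∘ proj₁)))
  where
  a∉w : a ∉ w
  a∉w = All.All¬⇒¬Any t≢w
... | _ | high = begin
  even (inversions (a ∷ map (swapAdj a) w))              ≡⟨ not-involutive _ ⟨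
  not (even (suc (inversions (a ∷ map (swapAdj a) w))))  ≡⟨ cong (not ∘ even) (cong₂ _+_
      (countSmaller-swapAdj-high a w a+1∉w (Any.tail (<⇒≢ (n<1+n a)) a∈) uw)
      (inversions-swapAdj a w (a+1∉w ∘ proj₂))) ⟩
  not (even (inversions (suc a ∷ w)))                   ∎
  where
  open ≡-Reasoning
  a+1∉w : suc a ∉ w
  a+1∉w = All.All¬⇒¬Any t≢w
... | _ | fixed t≢a t≢a+1 = begin
  even (countSmaller t (map (swapAdj a) w) + inversions (map (swapAdj a) w))
    ≡⟨ cong (λ c → even (c + inversions (map (swapAdj a) w))) countSmaller≡ ⟩
  even (countSmaller t w + inversions (map (swapAdj a) w))
    ≡⟨ even-+ (countSmaller t w) _ ⟩
  not (even (countSmaller t w)) xor even (inversions (map (swapAdj a) w))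
    ≡⟨ cong (not (even (countSmaller t w)) xor_)
         (inversions-swapAdj-parity a w uw (Any.tail (t≢a ∘ sym) a∈) (Any.tail (t≢a+1 ∘ sym) a+1∈)) ⟩
  not (even (countSmaller t w)) xor not (even (inversions w))
    ≡⟨ not-distribʳ-xor (not (even (countSmaller t w))) (even (inversions w)) ⟨
  not (not (even (countSmaller t w)) xor even (inversions w))
    ≡⟨ cong not (even-+ (countSmaller t w) (inversions w)) ⟨
  not (even (inversions (t ∷ w))) ∎
  where
  open ≡-Reasoning
  countSmaller≡ : countSmaller t (map (swapAdj a) w) ≡ countSmaller t w
  countSmaller≡ = trans (cong (λ v → countSmaller v (map (swapAdj a) w)) (sym (swapAdj-fixed t≢a t≢a+1)))
    (countSmaller-swapAdj a t w λ _ → λ { (inj₁ (_ , t≡a+1)) → t≢a+1 t≡a+1 ; (inj₂ (_ , t≡a)) → t≢a t≡a })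

-- A sign-reversing involution for odd insertion positions

pairLow : ℕ → ℕ
pairLow c = suc (c + c)

straddles : ℕ → ℕ → List ℕ → Bool
straddles i a w = memb a (take i w) xor memb (suc a) (take i w)

swapStraddling : ℕ → ℕ → List ℕ → List ℕ
swapStraddling zero    i w = w
swapStraddling (suc c) i w =
  if straddles i (pairLow c) w then map (swapAdj (pairLow c)) w else swapStraddling c i w

memb-take-map-swapAdj : ∀ a v i w → memb v (take i (map (swapAdj a) w)) ≡ memb (swapAdj a v) (take i w)
memb-take-map-swapAdj a v i w = trans (cong (memb v) (take-map i w)) (memb-map-swapAdj a v (take i w))

straddles-swapAdj : ∀ i a w → straddles i a (map (swapAdj a) w) ≡ straddles i a w
straddles-swapAdj i a w
  rewrite memb-take-map-swapAdj a a i w | memb-take-map-swapAdj a (suc a) i w | swapAdj-low a | swapAdj-high a =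
  xor-comm (memb (suc a) (take i w)) (memb a (take i w))

memb-take-swapStraddling : ∀ c i w v → c + c < v → memb v (take i (swapStraddling c i w)) ≡ memb v (take i w)
memb-take-swapStraddling zero    i w v _   = refl
memb-take-swapStraddling (suc c) i w v 2[c+1]<v with straddles i (pairLow c) w
... | true  = trans (memb-take-map-swapAdj (pairLow c) v i w)
                    (cong (λ u → memb u (take i w)) (swapAdj-fixed (>⇒≢ 2c+1<v) (>⇒≢ 2c+2<v)))
  where
  2c+2<v : suc (pairLow c) < v
  2c+2<v = subst (_< v) (+-suc (suc c) c) 2[c+1]<v
  2c+1<v : pairLow c < v
  2c+1<v = <-trans (n<1+n (pairLow c)) 2c+2<v
... | false = memb-take-swapStraddling c i w v (<-trans (+-mono-< (n<1+n c) (n<1+n c)) 2[c+1]<v)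

straddles-swapStraddling : ∀ c i w → straddles i (pairLow c) (swapStraddling c i w) ≡ straddles i (pairLow c) w
straddles-swapStraddling c i w
  rewrite memb-take-swapStraddling c i w (pairLow c) ≤-refl
        | memb-take-swapStraddling c i w (suc (pairLow c)) (n≤1+n (pairLow c)) = refl

-- Exchanging the values of the pair c changes no letter above 2c + 2 and leaves the pair
-- straddling, so the same pair is chosen again.
swapStraddling-involutive : ∀ c i w → swapStraddling c i (swapStraddling c i w) ≡ w
swapStraddling-involutive zero    i w = refl
swapStraddling-involutive (suc c) i w with straddles i (pairLow c) w in straddle
... | true  rewrite straddles-swapAdj i (pairLow c) w | straddle =
  trans (sym (map-∘ w)) (trans (map-cong (swapAdj-involutive (pairLow c)) w) (map-id w))
... | false rewrite straddles-swapStraddling c i w | straddle = swapStraddling-involutive c i w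

swapStraddling-view : ∀ c i w →
  (∀ c′ → c′ < c → straddles i (pairLow c′) w ≡ false) ⊎
  ∃ λ c′ → c′ < c × straddles i (pairLow c′) w ≡ true × swapStraddling c i w ≡ map (swapAdj (pairLow c′)) w
swapStraddling-view zero    i w = inj₁ (λ _ ())
swapStraddling-view (suc c) i w with straddles i (pairLow c) w in straddle
... | true  = inj₂ (c , ≤-refl , straddle , refl)
... | false with swapStraddling-view c i w
...   | inj₂ (c′ , c′<c , straddle′ , eq) = inj₂ (c′ , m<n⇒m<1+n c′<c , straddle′ , eq)
...   | inj₁ none = inj₁ none′
  where
  none′ : ∀ c′ → c′ < suc c → straddles i (pairLow c′) w ≡ false
  none′ c′ c′<c+1 with m≤n⇒m<n∨m≡n (≤-pred c′<c+1)
  ... | inj₁ c′<c = none c′ c′<c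
  ... | inj₂ refl = straddle

-- Otherwise the first i letters would be a union of pairs, so i would be even.
odd-prefix-straddles : ∀ {M i σ} → IsPermutation (M + M) σ → i ≤ M + M → even i ≡ false →
                       ¬ (∀ c → c < M → straddles i (pairLow c) σ ≡ false)
odd-prefix-straddles {M} {i} {σ} (isPermutation len≡ uσ letters) i≤ i-odd none =
  contradiction (trans (cong even #prefix) (even-double (∑ (upTo M) h))) (λ eq → case trans (sym eq) i-odd of λ ())
  where
  P = take i σ
  h = λ c → 𝟙 (memb (pairLow c) P)
  #prefix : i ≡ ∑ (upTo M) h + ∑ (upTo M) h
  #prefix = begin
    i
      ≡⟨ trans (length-take i σ) (m≤n⇒m⊓n≡m (subst (i ≤_) (sym len≡) i≤)) ⟨
    length P
      ≡⟨ length≡∑-memb (Unique.take⁺ i uσ) (Unique.map⁺ suc-injective (Unique.upTo⁺ (M + M)))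
                       (letter⇒∈ ∘ All.lookup letters ∘ ∈-take⁻ i σ) ⟩
    ∑ (map suc (upTo (M + M))) (λ y → 𝟙 (memb y P))
      ≡⟨ ∑-map suc (upTo (M + M)) _ ⟩
    ∑ (upTo (M + M)) (λ y → 𝟙 (memb (suc y) P))
      ≡⟨ ∑-upTo-double M _ ⟩
    ∑ (upTo M) (λ c → h c + 𝟙 (memb (suc (pairLow c)) P))
      ≡⟨ ∑-cong (λ {c} c∈ → cong (λ b → h c + 𝟙 b) (sym (xor-false⇒≡ (none c (∈-upTo⁻ c∈))))) ⟩
    ∑ (upTo M) (λ c → h c + h c)
      ≡⟨ ∑-+ (upTo M) h h ⟩
    ∑ (upTo M) h + ∑ (upTo M) h ∎
    where open ≡-Reasoning

straddles⇒¬both-take : ∀ {i a w} → straddles i a w ≡ true → ¬ (a ∈ take i w × suc a ∈ take i w)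
straddles⇒¬both-take straddle (a∈ , a+1∈) rewrite memb≡true a∈ | memb≡true a+1∈ = case straddle of λ ()

straddles⇒¬both-drop : ∀ {i a w} → Unique w → straddles i a w ≡ true → ¬ (a ∈ drop i w × suc a ∈ drop i w)
straddles⇒¬both-drop {i} uw straddle (a∈ , a+1∈)
  rewrite memb≡false (∈-drop⇒∉-take i uw a∈) | memb≡false (∈-drop⇒∉-take i uw a+1∈) = case straddle of λ ()

ascents-insert-straddling : ∀ {x a} i w → 0 < i → i < length w → Unique w → straddles i a w ≡ true →
  All (_< x) w → All (_< x) (map (swapAdj a) w) → ascents (insert x i (map (swapAdj a) w)) ≡ ascents (insert x i w)
ascents-insert-straddling {x} {a} (suc i) (y ∷ σ) _ _ uw straddle w<x sw<x = begin
  ascents (insert x (suc i) (map s (y ∷ σ)))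
    ≡⟨ ascents-insert-inner i (s y) (map s σ) sw<x ⟩
  suc (ascents (take (suc i) (map s (y ∷ σ))) + ascents (drop (suc i) (map s (y ∷ σ))))
    ≡⟨ cong suc (cong₂ _+_ (cong ascents (take-map (suc i) (y ∷ σ))) (cong ascents (drop-map (suc i) (y ∷ σ)))) ⟩
  suc (ascents (map s (take (suc i) (y ∷ σ))) + ascents (map s (drop (suc i) (y ∷ σ))))
    ≡⟨ cong suc (cong₂ _+_ (ascents-swapAdj a _ (straddles⇒¬both-take {suc i} {a} {y ∷ σ} straddle))
                           (ascents-swapAdj a _ (straddles⇒¬both-drop {suc i} uw straddle))) ⟩
  suc (ascents (take (suc i) (y ∷ σ)) + ascents (drop (suc i) (y ∷ σ)))
    ≡⟨ ascents-insert-inner i y σ w<x ⟨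
  ascents (insert x (suc i) (y ∷ σ)) ∎
  where
  open ≡-Reasoning
  s = swapAdj a

module OddPosition (M : ℕ) {i : ℕ} (i-odd : even i ≡ false) (i<2M : i < M + M) where

  τ : List ℕ → List ℕ
  τ = swapStraddling M i

  τ-swaps : ∀ {σ} → IsPermutation (M + M) σ →
            ∃ λ c → c < M × straddles i (pairLow c) σ ≡ true × τ σ ≡ map (swapAdj (pairLow c)) σ
  τ-swaps {σ} Pσ with swapStraddling-view M i σ
  ... | inj₁ none  = contradiction none (odd-prefix-straddles Pσ (<⇒≤ i<2M) i-odd)
  ... | inj₂ found = found

  pairLow<2M : ∀ {c} → c < M → suc (pairLow c) ≤ M + M
  pairLow<2M {c} c<M = subst (_≤ M + M) (cong suc (+-suc c c)) (+-mono-≤ c<M c<M)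

  τ-IsPermutation : ∀ {σ} → IsPermutation (M + M) σ → IsPermutation (M + M) (τ σ)
  τ-IsPermutation Pσ with c , c<M , _ , τσ≡ ← τ-swaps Pσ =
    subst (IsPermutation (M + M)) (sym τσ≡) (swapAdj-IsPermutation (s≤s z≤n) (pairLow<2M c<M) Pσ)

  τ-inversions : ∀ {σ} → IsPermutation (M + M) σ → even (inversions (τ σ)) ≡ not (even (inversions σ))
  τ-inversions {σ} Pσ@(isPermutation _ uσ _) with c , c<M , _ , τσ≡ ← τ-swaps Pσ =
    trans (cong (even ∘ inversions) τσ≡)
      (inversions-swapAdj-parity (pairLow c) σ uσ
        (IsPermutation⇒letter⇒∈ Pσ (s≤s z≤n , <⇒≤ (pairLow<2M c<M)))
        (IsPermutation⇒letter⇒∈ Pσ (s≤s z≤n , pairLow<2M c<M)))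

  τ-ascents-insert : ∀ {σ} → IsPermutation (M + M) σ →
                     ascents (insert (suc (M + M)) i (τ σ)) ≡ ascents (insert (suc (M + M)) i σ)
  τ-ascents-insert {σ} Pσ@(isPermutation len≡ uσ _) with c , c<M , straddle , τσ≡ ← τ-swaps Pσ rewrite τσ≡ =
    ascents-insert-straddling i σ (odd⇒positive i-odd) (subst (i <_) (sym len≡) i<2M) uσ straddle
      (IsPermutation⇒<suc Pσ) (IsPermutation⇒<suc (swapAdj-IsPermutation (s≤s z≤n) (pairLow<2M c<M) Pσ))

  ∑-parity-flip : ∀ (f : ℕ → Bool → ℕ) →
    ∑ (perms (M + M)) (λ σ → f (ascents (insert (suc (M + M)) i σ)) (not (even (inversions σ)))) ≡
    ∑ (perms (M + M)) (λ σ → f (ascents (insert (suc (M + M)) i σ)) (even (inversions σ)))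
  ∑-parity-flip f = begin
    ∑ (perms (M + M)) (λ σ → f (ascents (insert x i σ)) (not (even (inversions σ))))
      ≡⟨ ∑-cong (λ σ∈ → cong₂ f (sym (τ-ascents-insert (∈-perms⁻ σ∈))) (sym (τ-inversions (∈-perms⁻ σ∈)))) ⟩
    ∑ (perms (M + M)) (F ∘ τ)
      ≡⟨ ∑-involution F (perms-unique (M + M)) (∈-perms⁺ ∘ τ-IsPermutation ∘ ∈-perms⁻)
                      (λ _ → swapStraddling-involutive M i _) ⟩
    ∑ (perms (M + M)) F ∎
    where
    open ≡-Reasoning
    x = suc (M + M)
    F = λ σ → f (ascents (insert x i σ)) (even (inversions σ))

-- The recurrence

∑-insert-inversions : ∀ M (F : ℕ → Bool → ℕ) {i} → i ≤ M + M →
  ∑ (perms (M + M)) (λ σ → F (ascents (insert (suc (M + M)) i σ)) (even (inversions (insert (suc (M + M)) i σ)))) ≡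
  ∑ (perms (M + M)) (λ σ → F (ascents (insert (suc (M + M)) i σ)) (even (inversions σ)))
∑-insert-inversions M F {i} i≤2M =
  trans (∑-cong (λ σ∈ → cong (F _) (even-inversions-insert (∈-perms⁻ σ∈)))) by-parity-of-i
  where
  x = suc (M + M)
  even-inversions-insert : ∀ {σ} → IsPermutation (M + M) σ →
                           even (inversions (insert x i σ)) ≡ not (even i) xor even (inversions σ)
  even-inversions-insert {σ} Pσ@(isPermutation len≡ _ _) = begin
    even (inversions (insert x i σ))
      ≡⟨ cong even (inversions-insert i σ (IsPermutation⇒<suc Pσ)) ⟩
    even ((length σ ∸ i) + inversions σ)
      ≡⟨ even-+ (length σ ∸ i) (inversions σ) ⟩
    not (even (length σ ∸ i)) xor even (inversions σ)
      ≡⟨ cong (λ L → not (even (L ∸ i)) xor even (inversions σ)) len≡ ⟩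
    not (even (M + M ∸ i)) xor even (inversions σ)
      ≡⟨ cong (λ e → not e xor even (inversions σ)) (even-∸ (even-double M) i≤2M) ⟩
    not (even i) xor even (inversions σ) ∎
    where open ≡-Reasoning
  by-parity-of-i : ∑ (perms (M + M)) (λ σ → F (ascents (insert x i σ)) (not (even i) xor even (inversions σ))) ≡
                   ∑ (perms (M + M)) (λ σ → F (ascents (insert x i σ)) (even (inversions σ)))
  by-parity-of-i with even i in i-parity
  ... | true  = refl
  ... | false = OddPosition.∑-parity-flip M i-parity (≤∧≢⇒< i≤2M i≢2M) F
    where
    i≢2M : i ≢ M + M
    i≢2M refl = case trans (sym i-parity) (even-double M) of λ ()

-- parityIs true selects the permutations counted by B (even number of inversions), parityIs
-- false those counted by C.
parityIs : Bool → List ℕ → Bool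
parityIs b w = not b xor even (inversions w)

∑-parity-Eulerian : ∀ M k b → let N = M + M in
  ∑ (perms (suc N)) (λ w → 𝟙 (⌊ ascents w ≟ k ⌋ ∧ parityIs b w)) ≡
  (suc N ∸ k) * ∑ (perms N) (λ σ → 𝟙 (⌊ suc (ascents σ) ≟ k ⌋ ∧ parityIs b σ)) +
  suc k * ∑ (perms N) (λ σ → 𝟙 (⌊ ascents σ ≟ k ⌋ ∧ parityIs b σ))
∑-parity-Eulerian M k b = begin
  ∑ (perms (suc N)) G
    ≡⟨ ∑-perms-suc N G ⟩
  ∑ (perms N) (λ σ → ∑ positions (λ i → G (insert x i σ)))
    ≡⟨ ∑-comm (perms N) positions (λ σ i → G (insert x i σ)) ⟩
  ∑ positions (λ i → ∑ (perms N) (λ σ → G (insert x i σ)))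
    ≡⟨ ∑-cong (λ i∈ → ∑-insert-inversions M F (≤-pred (∈-upTo⁻ i∈))) ⟩
  ∑ positions (λ i → ∑ (perms N) (λ σ → H σ (ascents (insert x i σ))))
    ≡⟨ ∑-comm (perms N) positions (λ σ i → H σ (ascents (insert x i σ))) ⟨
  ∑ (perms N) (λ σ → ∑ positions (λ i → H σ (ascents (insert x i σ))))
    ≡⟨ ∑-cong (λ {σ} σ∈ → ∑-insert-ascents≟ {N} k (parityIs b σ) (∈-perms⁻ σ∈)) ⟩
  ∑ (perms N) (λ σ → suc k * inEₖ σ + (suc N ∸ k) * inEₖ₋₁ σ)
    ≡⟨ ∑-+ (perms N) _ _ ⟩
  ∑ (perms N) (λ σ → suc k * inEₖ σ) + ∑ (perms N) (λ σ → (suc N ∸ k) * inEₖ₋₁ σ)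
    ≡⟨ cong₂ _+_ (∑-*ˡ (suc k) (perms N) inEₖ) (∑-*ˡ (suc N ∸ k) (perms N) inEₖ₋₁) ⟩
  suc k * ∑ (perms N) inEₖ + (suc N ∸ k) * ∑ (perms N) inEₖ₋₁
    ≡⟨ +-comm (suc k * ∑ (perms N) inEₖ) _ ⟩
  (suc N ∸ k) * ∑ (perms N) inEₖ₋₁ + suc k * ∑ (perms N) inEₖ ∎
  where
  open ≡-Reasoning
  N = M + M
  x = suc N
  positions = upTo (suc N)
  G = λ w → 𝟙 (⌊ ascents w ≟ k ⌋ ∧ parityIs b w)
  F = λ a e → 𝟙 (⌊ a ≟ k ⌋ ∧ (not b xor e))
  H = λ σ a → 𝟙 (⌊ a ≟ k ⌋ ∧ parityIs b σ)
  inEₖ = λ σ → 𝟙 (⌊ ascents σ ≟ k ⌋ ∧ parityIs b σ)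
  inEₖ₋₁ = λ σ → 𝟙 (⌊ suc (ascents σ) ≟ k ⌋ ∧ parityIs b σ)
-- Imported only here: its prefix operator +_ makes sections such as (m +_) above ambiguous.
open import Data.Integer using (+_) renaming (_-_ to _-ℤ_)

hasAscents-pred : ∀ k w → hasAscents (+ k -ℤ + 1) w ≡ ⌊ suc (ascents w) ≟ k ⌋
hasAscents-pred zero    w = refl
hasAscents-pred (suc k) w with ascents w ≟ k | suc (ascents w) ≟ suc k
... | yes _   | yes _     = refl
... | no  _   | no  _     = refl
... | yes s≡k | no  s+1≢  = contradiction (cong suc s≡k) s+1≢
... | no  s≢k | yes s+1≡  = contradiction (suc-injective s+1≡) s≢k

length-E-parity : ∀ m k b →
  length (filter (T? ∘ parityIs b) (E m k)) ≡ ∑ (perms m) (λ w → 𝟙 (hasAscents k w ∧ parityIs b w))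
length-E-parity m k b = length-filter-filter (hasAscents k) (parityIs b) (perms m)

parity-Eulerian-recurrence : ∀ M k b → let n = suc (M + M) in
  length (filter (T? ∘ parityIs b) (E n (+ k))) ≡
  (n ∸ k) * length (filter (T? ∘ parityIs b) (E (n ∸ 1) (+ k -ℤ + 1))) +
  suc k * length (filter (T? ∘ parityIs b) (E (n ∸ 1) (+ k)))
parity-Eulerian-recurrence M k b = begin
  length (filter (T? ∘ parityIs b) (E (suc N) (+ k)))
    ≡⟨ length-E-parity (suc N) (+ k) b ⟩
  ∑ (perms (suc N)) (λ w → 𝟙 (⌊ ascents w ≟ k ⌋ ∧ parityIs b w))
    ≡⟨ ∑-parity-Eulerian M k b ⟩
  (suc N ∸ k) * ∑ (perms N) (λ σ → 𝟙 (⌊ suc (ascents σ) ≟ k ⌋ ∧ parityIs b σ)) +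
  suc k * ∑ (perms N) (λ σ → 𝟙 (⌊ ascents σ ≟ k ⌋ ∧ parityIs b σ))
    ≡⟨ cong₂ (λ a c → (suc N ∸ k) * a + suc k * c) (sym length-Eₖ₋₁) (sym (length-E-parity N (+ k) b)) ⟩
  (suc N ∸ k) * length (filter (T? ∘ parityIs b) (E N (+ k -ℤ + 1))) +
  suc k * length (filter (T? ∘ parityIs b) (E N (+ k))) ∎
  where
  open ≡-Reasoning
  N = M + M
  length-Eₖ₋₁ : length (filter (T? ∘ parityIs b) (E N (+ k -ℤ + 1))) ≡
                ∑ (perms N) (λ σ → 𝟙 (⌊ suc (ascents σ) ≟ k ⌋ ∧ parityIs b σ))
  length-Eₖ₋₁ = trans (length-E-parity N (+ k -ℤ + 1) b)
    (∑-cong {xs = perms N} (λ {σ} _ → cong (λ h → 𝟙 (h ∧ parityIs b σ)) (hasAscents-pred k σ)))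

2*m+1≡1+m+m : ∀ m → 2 * m + 1 ≡ suc (m + m)
2*m+1≡1+m+m m = trans (+-comm (2 * m) 1) (cong (λ t → suc (m + t)) (+-identityʳ m))

corollary3p3 : (n k : ℕ) → 3 ≤ n → (∃ λ j → n ≡ 2 * j + 1) → k < n →
    (B n (+ k) ≡ (n ∸ k) * B (n ∸ 1) (+ k -ℤ + 1) + suc k * B (n ∸ 1) (+ k))
    × (C n (+ k) ≡ (n ∸ k) * C (n ∸ 1) (+ k -ℤ + 1) + suc k * C (n ∸ 1) (+ k))
corollary3p3 n k _ (j , n≡2j+1) _ rewrite trans n≡2j+1 (2*m+1≡1+m+m j) =
  parity-Eulerian-recurrence j k true , parity-Eulerian-recurrence j k false
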